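{- In a closed simple resource interaction net $\mathcal{N}$, the conclusion of an exponential link (a $!$-link or a $?$-link) is either the first premise of a linear implication link ($\multimap$ or $\overline{\multimap}$), or a cut with another exponential link.
   Context: Resource calculus: simple terms $t ::= \star \mid x \mid \lambda x.t \mid t\,B$, simple polyterms $B ::= 1 \mid [t] \mid B\cdot B$ (finite multisets of simple terms, $\cdot$ multiset union, $1$ empty multiset); terms are finite formal sums of simple terms with coefficients in $\mathbf{N}$, constructors extended by linearity. Reduction: $(\lambda x.s)[t_1,\ldots,t_n] \to \sum_{\sigma\in S_n} s\{t_1/x_{\sigma(1)},\ldots,t_n/x_{\sigma(n)}\}$ if $n=m$, where $x_1,\ldots,x_m$ are the free occurrences of $x$ in $s$, and $\to 0$ if $n\neq m$ (closed under contexts and sums). Types: $T ::= \star \mid !T \multimap T$. Links are triples (sequence of premise vertices, kind, one conclusion vertex) with kinds $\star$ (arity 0), $\multimap$ (abstraction), $\overline{\multimap}$ (application), $!$ and $?$ ($n$-ary, $n\ge 0$; arity-0 ones are co-weakening and weakening). Typing: $\star$-link conclusion has type $\star$; a $\multimap$-link and a $\overline{\multimap}$-link both have premises of types $A$ (first) and $B$ (second) and conclusion of type $A\multimap B$; a $!$-link and a $?$-link both have $n$ premises of type $A$ and conclusion of type $!A$. Each link assigns a polarity (in/out) to its vertices; a simple pre-net is a set of typed vertices and links such that each vertex belongs to one or two links (with opposite polarities when two); vertices in only one link are the conclusions of the pre-net; it is closed if it has a single conclusion, which is out. A cut is a vertex that is the conclusion of two links. The translation $[\![t]\!]$ of a simple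 term maps $\star$ to a $\star$-link, $\lambda x.t$ to a $\multimap$-link whose first premise is the conclusion of a $?$-link gathering all occurrences of $x$ and whose second premise is the translation of $t$, $t\,S$ to a $\overline{\multimap}$-link whose conclusion is the output of $[\![t]\!]$, first premise the output of $[\![S]\!]$, $[s_1,\ldots,s_n]$ to a $!$-link whose premises are the outputs of the $[\![s_i]\!]$, and free variables get a $?$-link on their occurrences. Net reduction on simple pre-nets (extended to sums): a cut $w$ between $\multimap$-link with premises $u,v$ and $\overline{\multimap}$-link with premises $u',v'$ is eliminated by removing both links and identifying $u\equiv u'$, $v\equiv v'$; a cut between a $!$-link with premises $v_1,\ldots,v_n$ and a $?$-link with premises $u_1,\ldots,u_m$ reduces to $\sum_{\sigma\in S_n}$ copies of the net with $v_i\equiv u_{\sigma(i)}$ if $n=m$, and to $0$ if $n\neq m$. A simple (resource interaction) net is an addend of some $\mathcal{S}$ with $[\![t]\!]\to^*\mathcal{S}$ for a simple term $t$ (for which $[\![t]\!]$ is a well-typed pre-net). -}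

module Defs where

open import Data.Nat using (ℕ; zero; suc; _≟_)
open import Data.List using (List; []; _∷_; _++_; map; concatMap; length; filter; deduplicate; zip)
open import Data.List.Relation.Unary.All using (All)
open import Data.List.Membership.Propositional using (_∈_)
open import Data.List.Relation.Binary.Permutation.Propositional using (_↭_)
open import Data.Product using (Σ; ∃; ∃₂; _×_; _,_; proj₁; proj₂)
open import Data.Sum using (_⊎_)
open import Data.Unit using (⊤)
open import Data.Empty using (⊥)
open import Data.Bool using (if_then_else_)
open import Function using (id)
open import Relation.Nullary using (¬_; ¬?)
open import Relation.Nullary.Decidable using (⌊_⌋)
open import Relation.Binary.PropositionalEquality using (_≡_)
open import Relation.Binary.Construct.Closure.ReflexiveTransitive using (Star)

-- A simple polyterm (finite multiset of simple terms) is represented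
-- by a list; its order is irrelevant for the translation up to iso.

data STerm : Set where
  star : STerm
  var  : ℕ → STerm
  lam  : ℕ → STerm → STerm
  app  : STerm → List STerm → STerm

-- Types.  T ::= ⋆ | !T ⊸ T ;  `A ⊸ B` below stands for  !A ⊸ B.
-- Vertices carry either a type T or an exponential type !T.

data Ty : Set where
  ⋆   : Ty
  _⊸_ : Ty → Ty → Ty

data VTy : Set where
  base : Ty → VTy
  bang : Ty → VTy

data Kind : Set where
  kStar kLolli kLolliBar kBang kWhy : Kind

record Link : Set where
  constructor link
  field
    prem  : List ℕ
    kind  : Kind
    concl : ℕ
open Link public

data IsExp : Kind → Set where
  expBang : IsExp kBang
  expWhy  : IsExp kWhy

data IsLin : Kind → Set where
  linLolli    : IsLin kLolli
  linLolliBar : IsLin kLolliBar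

data Pol : Set where
  pin pout : Pol

conclPol : Kind → Pol
conclPol kStar     = pout
conclPol kLolli    = pout
conclPol kLolliBar = pin
conclPol kBang     = pout
conclPol kWhy      = pin

-- polarity of the i-th premise (i counted from 0)
premPol : Kind → ℕ → Pol
premPol kStar     _       = pout
premPol kLolli    zero    = pout
premPol kLolli    (suc _) = pin
premPol kLolliBar zero    = pin
premPol kLolliBar (suc _) = pout
premPol kBang     _       = pin
premPol kWhy      _       = pout

premOcc : ℕ → Kind → ℕ → List ℕ → List Pol
premOcc v k i []       = []
premOcc v k i (p ∷ ps) = (if ⌊ p ≟ v ⌋ then premPol k i ∷ [] else []) ++ premOcc v k (suc i) ps

linkPols : ℕ → Link → List Pol
linkPols v (link ps k c) = (if ⌊ c ≟ v ⌋ then conclPol k ∷ [] else []) ++ premOcc v k 0 ps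

occPols : ℕ → List Link → List Pol
occPols v []       = []
occPols v (l ∷ ls) = linkPols v l ++ occPols v ls

vertices : List Link → List ℕ
vertices = concatMap (λ l → concl l ∷ prem l)

ValidOcc : List Pol → Set
ValidOcc (_ ∷ [])     = ⊤
ValidOcc (p ∷ q ∷ []) = ¬ (p ≡ q)
ValidOcc _            = ⊥

ArityOK : Link → Set
ArityOK (link ps kStar _)     = ps ≡ []
ArityOK (link ps kLolli _)    = length ps ≡ 2
ArityOK (link ps kLolliBar _) = length ps ≡ 2
ArityOK (link ps kBang _)     = ⊤
ArityOK (link ps kWhy _)      = ⊤

IsPreNet : List Link → Set
IsPreNet ls = All ArityOK ls × (∀ v → v ∈ vertices ls → ValidOcc (occPols v ls))

record PreNet : Set where
  constructor mkNet
  field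
    links : List Link
    ty    : ℕ → VTy
open PreNet public

LinTyped : (ℕ → VTy) → List ℕ → ℕ → Set
LinTyped ty (u ∷ v ∷ []) c =
  ∃₂ λ A B → ty u ≡ bang A × ty v ≡ base B × ty c ≡ base (A ⊸ B)
LinTyped ty _ c = ⊥

ExpTyped : (ℕ → VTy) → List ℕ → ℕ → Set
ExpTyped ty ps c = ∃ λ A → All (λ p → ty p ≡ base A) ps × ty c ≡ bang A

LinkTyped : (ℕ → VTy) → Link → Set
LinkTyped ty (link ps kStar c)     = ty c ≡ base ⋆
LinkTyped ty (link ps kLolli c)    = LinTyped ty ps c
LinkTyped ty (link ps kLolliBar c) = LinTyped ty ps c
LinkTyped ty (link ps kBang c)     = ExpTyped ty ps c
LinkTyped ty (link ps kWhy c)      = ExpTyped ty ps c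

WellTyped : PreNet → Set
WellTyped N = All (LinkTyped (ty N)) (links N)

occsOf : ℕ → List (ℕ × ℕ) → List ℕ
occsOf x occ = map proj₂ (filter (λ p → proj₁ p ≟ x) occ)

removeVar : ℕ → List (ℕ × ℕ) → List (ℕ × ℕ)
removeVar x = filter (λ p → ¬? (proj₁ p ≟ x))

record TrOut : Set where
  constructor trOut
  field
    out   : ℕ
    tlinks : List Link
    occ   : List (ℕ × ℕ)      -- (variable, vertex of a free occurrence)
    next  : ℕ

record BagOut : Set where
  constructor bagOut
  field
    outs   : List ℕ
    blinks : List Link
    bocc   : List (ℕ × ℕ)
    bnext  : ℕ

mutual
  tr : STerm → ℕ → TrOut
  tr star n = trOut n (link [] kStar n ∷ []) [] (suc n)
  tr (var x) n = trOut n [] ((x , n) ∷ []) (suc n)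
  tr (lam x t) n with tr t n
  ... | trOut o ls oc a =
    trOut (suc a)
          (link (occsOf x oc) kWhy a ∷ link (a ∷ o ∷ []) kLolli (suc a) ∷ ls)
          (removeVar x oc) (suc (suc a))
  tr (app t B) n with tr t n
  ... | trOut o ls oc m with trBag B m
  ... | bagOut os bls boc b =
    trOut (suc b)
          (link (b ∷ suc b ∷ []) kLolliBar o ∷ link os kBang b ∷ ls ++ bls)
          (oc ++ boc) (suc (suc b))

  trBag : List STerm → ℕ → BagOut
  trBag [] n = bagOut [] [] [] n
  trBag (s ∷ ss) n with tr s n
  ... | trOut o ls oc m with trBag ss m
  ... | bagOut os bls boc k = bagOut (o ∷ os) (ls ++ bls) (oc ++ boc) k

closeFV : List ℕ → List (ℕ × ℕ) → ℕ → List Link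
closeFV []       occ n = []
closeFV (x ∷ xs) occ n = link (occsOf x occ) kWhy n ∷ closeFV xs occ (suc n)

⟦_⟧ : STerm → List Link
⟦ t ⟧ with tr t 0
... | trOut o ls oc m = ls ++ closeFV (deduplicate _≟_ (map proj₁ oc)) oc m

ren : ℕ → ℕ → ℕ → ℕ
ren a b x = if ⌊ x ≟ b ⌋ then a else x

quot : List (ℕ × ℕ) → (ℕ → ℕ) → (ℕ → ℕ)
quot []             ρ = ρ
quot ((a , b) ∷ ps) ρ = quot ps (λ x → ren (ρ a) (ρ b) (ρ x))

renameLink : (ℕ → ℕ) → Link → Link
renameLink ρ (link ps k c) = link (map ρ ps) k (ρ c)

identify : List (ℕ × ℕ) → List Link → List Link
identify ps = map (renameLink (quot ps id))

insertions : {A : Set} → A → List A → List (List A)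
insertions x []       = (x ∷ []) ∷ []
insertions x (y ∷ ys) = (x ∷ y ∷ ys) ∷ map (y ∷_) (insertions x ys)

-- all n! permutations (with multiplicity) of a list
perms : {A : Set} → List A → List (List A)
perms []       = [] ∷ []
perms (x ∷ xs) = concatMap (insertions x) (perms xs)

-- one reduction step of a simple pre-net, producing a sum (list) of pre-nets
data _⇒_ : PreNet → List PreNet → Set where
  ⇒lin : ∀ {ls ty u v u′ v′ w rest} →
         ls ↭ (link (u ∷ v ∷ []) kLolli w ∷ link (u′ ∷ v′ ∷ []) kLolliBar w ∷ rest) →
         mkNet ls ty ⇒ (mkNet (identify ((u , u′) ∷ (v , v′) ∷ []) rest) ty ∷ [])
  ⇒exp : ∀ {ls ty vs us w rest} →
         ls ↭ (link vs kBang w ∷ link us kWhy w ∷ rest) →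
         length vs ≡ length us →
         mkNet ls ty ⇒ map (λ us′ → mkNet (identify (zip vs us′) rest) ty) (perms us)
  ⇒exp0 : ∀ {ls ty vs us w rest} →
         ls ↭ (link vs kBang w ∷ link us kWhy w ∷ rest) →
         ¬ (length vs ≡ length us) →
         mkNet ls ty ⇒ []

data _↝_ : List PreNet → List PreNet → Set where
  step : ∀ {A N R B} → N ⇒ R → (A ++ N ∷ B) ↝ (A ++ R ++ B)

_↝*_ : List PreNet → List PreNet → Set
_↝*_ = Star _↝_

SimpleNet : PreNet → Set
SimpleNet N = Σ STerm λ t → Σ (ℕ → VTy) λ ty → Σ (List PreNet) λ S →
  IsPreNet ⟦ t ⟧ × WellTyped (mkNet ⟦ t ⟧ ty) ×
  ((mkNet ⟦ t ⟧ ty ∷ []) ↝* S) × N ∈ S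

Closed : PreNet → Set
Closed N = ∃ λ v → occPols v (links N) ≡ pout ∷ [] ×
  (∀ w → w ∈ vertices (links N) → length (occPols w (links N)) ≡ 1 → w ≡ v)

FirstPremiseOfLin : ℕ → List Link → Set
FirstPremiseOfLin v ls = ∃ λ l′ → l′ ∈ ls × IsLin (kind l′) × ∃ λ ps → prem l′ ≡ v ∷ ps

CutWithExp : ℕ → List Link → Set
CutWithExp v rest = ∃ λ l′ → l′ ∈ rest × IsExp (kind l′) × concl l′ ≡ v

-- Record, for every vertex, its occurrences in links together with the polarity the link
-- assigns ("slots").  In the translation of a term, each vertex has at most one slot of each
-- polarity, and a vertex of type !A has no more out-slots than in-slots: every !-conclusion is
-- the first premise of an application and every first premise of an abstraction is the
-- conclusion of a ?-link.  Both properties survive reduction, because a cut-elimination step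
-- deletes one in- and one out-slot of the cut vertex and then identifies the remaining premises
-- pairwise, always an in-slot with an out-slot.  In a well-typed link a vertex of type !A is
-- either the conclusion of an exponential link or the first premise of a linear one.  So the
-- conclusion of a !-link has an in-slot in some other link, and the conclusion of a ?-link an
-- out-slot in some other link, since it is not the (out) conclusion of the closed net.

module Submission where

open import Defs
open import Data.Bool using (if_then_else_)
open import Data.Empty using (⊥; ⊥-elim)
open import Data.List using (List; []; _∷_; _++_; map; length; zip; concatMap)
open import Data.List.Properties using (map-∘; map-cong; map-id; map-++; ++-assoc; length-map)
open import Data.List.Membership.Propositional using (_∈_; _∉_; find; lose)
open import Data.List.Membership.Propositional.Properties
  using (∈-++⁻; ∈-++⁺ˡ; ∈-++⁺ʳ; ∈-map⁻; ∈-concatMap⁺; ∈-concatMap⁻; ∈-concat⁻′)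
open import Data.List.Relation.Binary.Permutation.Propositional as ↭
  using (_↭_; prep; swap; ↭-sym; ↭-trans; ↭-reflexive)
open import Data.List.Relation.Binary.Permutation.Propositional.Properties
  using (++⁺ˡ; ++⁺ʳ; shift; shifts; map⁺; ∈-resp-↭; All-resp-↭; ↭-length)
open import Data.List.Relation.Binary.Subset.Propositional using (_⊆_)
open import Data.List.Relation.Unary.All as All using (All; []; _∷_)
import Data.List.Relation.Unary.All.Properties as AllP
open import Data.List.Relation.Unary.Any using (here; there)
open import Data.Nat using (ℕ; zero; suc; _+_; _*_; _≤_; _≟_; _≤?_; z≤n; s≤s; s≤s⁻¹)
open import Data.Nat.ListAction using (sum)
open import Data.Nat.ListAction.Properties using (sum-++; sum-↭)
open import Data.Nat.Properties
open import Algebra.Properties.CommutativeSemigroup +-commutativeSemigroup using (interchange)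
open import Data.Product using (∃; _×_; _,_; proj₁; proj₂; map₁)
open import Data.Sum using (_⊎_; inj₁; inj₂; [_,_]′)
open import Data.Unit using (⊤; tt)
open import Function using (_∘_; id)
open import Relation.Binary.Construct.Closure.ReflexiveTransitive using (ε; _◅_)
open import Relation.Nullary using (yes; no)
open import Relation.Nullary.Decidable using (⌊_⌋)
open import Relation.Binary.PropositionalEquality
  using (_≡_; _≢_; refl; sym; trans; cong; cong₂; subst; subst₂; module ≡-Reasoning)

dual : Pol → Pol
dual pin  = pout
dual pout = pin

δ : Pol → Pol → ℕ
δ pin  pin  = 1
δ pout pout = 1
δ _    _    = 0

δ-dual : ∀ q p → δ q p + δ q (dual p) ≡ 1
δ-dual pin  pin  = refl
δ-dual pin  pout = refl
δ-dual pout pin  = refl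
δ-dual pout pout = refl

δ-refl : ∀ q → δ q q ≡ 1
δ-refl pin  = refl
δ-refl pout = refl

δ≤1 : ∀ q p → δ q p ≤ 1
δ≤1 q p = m+n≤o⇒m≤o (δ q p) (≤-reflexive (δ-dual q p))

δ-pos-or : ∀ q p {n} → 1 ≤ δ q p + n → p ≡ q ⊎ 1 ≤ n
δ-pos-or pin  pin  _ = inj₁ refl
δ-pos-or pout pout _ = inj₁ refl
δ-pos-or pin  pout h = inj₂ h
δ-pos-or pout pin  h = inj₂ h

≢⇒dual : ∀ {p p′} → p ≢ p′ → p′ ≡ dual p
≢⇒dual {pin}  {pin}  p≢p′ = ⊥-elim (p≢p′ refl)
≢⇒dual {pin}  {pout} _    = refl
≢⇒dual {pout} {pin}  _    = refl
≢⇒dual {pout} {pout} p≢p′ = ⊥-elim (p≢p′ refl)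

_≐_ : ℕ → ℕ → ℕ
y ≐ x = if ⌊ y ≟ x ⌋ then 1 else 0

≐-refl : ∀ x → x ≐ x ≡ 1
≐-refl x with x ≟ x
... | yes _   = refl
... | no x≢x = ⊥-elim (x≢x refl)

≐-≢ : ∀ {y x} → y ≢ x → y ≐ x ≡ 0
≐-≢ {y} {x} y≢x with y ≟ x
... | yes y≡x = ⊥-elim (y≢x y≡x)
... | no _    = refl

-- Slots

Slot : Set
Slot = ℕ × Pol

premSlots : Kind → ℕ → List ℕ → List Slot
premSlots k i []       = []
premSlots k i (p ∷ ps) = (p , premPol k i) ∷ premSlots k (suc i) ps

slots : Link → List Slot
slots (link ps k c) = (c , conclPol k) ∷ premSlots k 0 ps

allSlots : List Link → List Slot
allSlots = concatMap slots

renameSlots : (ℕ → ℕ) → List Slot → List Slot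
renameSlots ρ = map (map₁ ρ)

weigh : (ℕ → ℕ) → Pol → List Slot → ℕ
weigh g q = sum ∘ map (λ s → g (proj₁ s) * δ q (proj₂ s))

count : Pol → ℕ → List Slot → ℕ
count q x = weigh (_≐ x) q

weigh-++ : ∀ g q xs ys → weigh g q (xs ++ ys) ≡ weigh g q xs + weigh g q ys
weigh-++ g q xs ys = trans (cong sum (map-++ _ xs ys)) (sum-++ (map _ xs) _)

weigh-↭ : ∀ g q {xs ys} → xs ↭ ys → weigh g q xs ≡ weigh g q ys
weigh-↭ g q xs↭ys = sum-↭ (map⁺ _ xs↭ys)

weigh-cong : ∀ {g h} → (∀ v → g v ≡ h v) → ∀ q ss → weigh g q ss ≡ weigh h q ss
weigh-cong g≗h q ss = cong sum (map-cong (λ s → cong (_* δ q (proj₂ s)) (g≗h (proj₁ s))) ss)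

weigh-+ : ∀ {g h k} → (∀ v → g v ≡ h v + k v) → ∀ q ss → weigh g q ss ≡ weigh h q ss + weigh k q ss
weigh-+ g≗h+k q [] = refl
weigh-+ {g} {h} {k} g≗h+k q ((v , p) ∷ ss) = begin
  g v * δ q p + weigh g q ss
    ≡⟨ cong₂ _+_ (trans (cong (_* δ q p) (g≗h+k v)) (*-distribʳ-+ (δ q p) (h v) (k v)))
                 (weigh-+ {g} {h} {k} g≗h+k q ss) ⟩
  (h v * δ q p + k v * δ q p) + (weigh h q ss + weigh k q ss)
    ≡⟨ interchange (h v * δ q p) (k v * δ q p) (weigh h q ss) (weigh k q ss) ⟩
  (h v * δ q p + weigh h q ss) + (k v * δ q p + weigh k q ss) ∎
  where open ≡-Reasoning

weigh-zero : ∀ q ss → weigh (λ _ → 0) q ss ≡ 0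
weigh-zero q []       = refl
weigh-zero q (_ ∷ ss) = weigh-zero q ss

count-∷-≡ : ∀ q x p ss → count q x ((x , p) ∷ ss) ≡ δ q p + count q x ss
count-∷-≡ q x p ss =
  trans (cong (λ n → n * δ q p + count q x ss) (≐-refl x)) (cong (_+ count q x ss) (*-identityˡ (δ q p)))

count-∷-≢ : ∀ {v} q x p ss → v ≢ x → count q x ((v , p) ∷ ss) ≡ count q x ss
count-∷-≢ q x p ss v≢x = cong (λ n → n * δ q p + count q x ss) (≐-≢ v≢x)

count-rename : ∀ ρ q x ss → count q x (renameSlots ρ ss) ≡ weigh (λ v → ρ v ≐ x) q ss
count-rename ρ q x ss = cong sum (sym (map-∘ ss))

count-pos⇒∈ : ∀ q x ss → 1 ≤ count q x ss → (x , q) ∈ ss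
-- `with v ≟ x` also evaluates the indicator v ≐ x in the type of pos.
count-pos⇒∈ q x ((v , p) ∷ ss) pos with v ≟ x
... | no _     = there (count-pos⇒∈ q x ss pos)
... | yes refl with δ-pos-or q p (subst (λ n → 1 ≤ n + count q x ss) (*-identityˡ (δ q p)) pos)
...   | inj₁ refl = here refl
...   | inj₂ pos′ = there (count-pos⇒∈ q x ss pos′)

∈⇒count-pos : ∀ {q x ss} → (x , q) ∈ ss → 1 ≤ count q x ss
∈⇒count-pos {q} {x} {_ ∷ ss} (here refl) =
  subst (1 ≤_) (sym (count-∷-≡ q x q ss)) (subst (λ n → 1 ≤ n + count q x ss) (sym (δ-refl q)) (s≤s z≤n))
∈⇒count-pos {ss = _ ∷ _} (there s) = ≤-trans (∈⇒count-pos s) (m≤n+m _ _)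

premSlots-rename : ∀ ρ k i ps → premSlots k i (map ρ ps) ≡ renameSlots ρ (premSlots k i ps)
premSlots-rename ρ k i []       = refl
premSlots-rename ρ k i (p ∷ ps) = cong (_ ∷_) (premSlots-rename ρ k (suc i) ps)

allSlots-rename : ∀ ρ ls → allSlots (map (renameLink ρ) ls) ≡ renameSlots ρ (allSlots ls)
allSlots-rename ρ []                   = refl
allSlots-rename ρ (link ps k c ∷ ls) = begin
  (ρ c , conclPol k) ∷ premSlots k 0 (map ρ ps) ++ allSlots (map (renameLink ρ) ls)
    ≡⟨ cong₂ (λ xs ys → (ρ c , conclPol k) ∷ xs ++ ys) (premSlots-rename ρ k 0 ps) (allSlots-rename ρ ls) ⟩
  (ρ c , conclPol k) ∷ renameSlots ρ (premSlots k 0 ps) ++ renameSlots ρ (allSlots ls)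
    ≡⟨ cong (_ ∷_) (map-++ _ (premSlots k 0 ps) (allSlots ls)) ⟨
  renameSlots ρ (slots (link ps k c) ++ allSlots ls) ∎
  where open ≡-Reasoning

allSlots-↭ : ∀ {ls ls′} → ls ↭ ls′ → allSlots ls ↭ allSlots ls′
allSlots-↭ ↭.refl          = ↭.refl
allSlots-↭ (prep l p)      = ++⁺ˡ (slots l) (allSlots-↭ p)
allSlots-↭ (swap l l′ p)   = ↭-trans (shifts (slots l) (slots l′)) (++⁺ˡ (slots l′) (++⁺ˡ (slots l) (allSlots-↭ p)))
allSlots-↭ (↭.trans p p′)  = ↭-trans (allSlots-↭ p) (allSlots-↭ p′)

∈-allSlots⁻ : ∀ {s} ls → s ∈ allSlots ls → ∃ λ l → l ∈ ls × s ∈ slots l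
∈-allSlots⁻ ls s∈ = find (∈-concatMap⁻ slots {ls} s∈)

∈-allSlots⁺ : ∀ {s l ls} → l ∈ ls → s ∈ slots l → s ∈ allSlots ls
∈-allSlots⁺ l∈ s∈ = ∈-concatMap⁺ slots (lose l∈ s∈)

allSlots-⊆ : ∀ {ls ls′} → ls ⊆ ls′ → allSlots ls ⊆ allSlots ls′
allSlots-⊆ {ls} ls⊆ s∈ = let _ , l∈ , s∈l = ∈-allSlots⁻ ls s∈ in ∈-allSlots⁺ (ls⊆ l∈) s∈l

∈-premSlots⇒∈ : ∀ {x q k i ps} → (x , q) ∈ premSlots k i ps → x ∈ ps
∈-premSlots⇒∈ {ps = _ ∷ _} (here refl) = here refl
∈-premSlots⇒∈ {ps = _ ∷ _} (there s)   = there (∈-premSlots⇒∈ s)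

∈-allSlots⇒∈-vertices : ∀ {x q} ls → (x , q) ∈ allSlots ls → x ∈ vertices ls
∈-allSlots⇒∈-vertices ls s∈ with ∈-allSlots⁻ ls s∈
... | link ps k c , l∈ , here refl = ∈-concatMap⁺ _ (lose l∈ (here refl))
... | link ps k c , l∈ , there s   = ∈-concatMap⁺ _ (lose l∈ (there (∈-premSlots⇒∈ s)))

countPol : Pol → List Pol → ℕ
countPol q = sum ∘ map (δ q)

countPol-++ : ∀ q xs ys → countPol q (xs ++ ys) ≡ countPol q xs + countPol q ys
countPol-++ q xs ys = trans (cong sum (map-++ (δ q) xs ys)) (sum-++ (map (δ q) xs) _)

countPol-if : ∀ q v x p r →
  countPol q ((if ⌊ v ≟ x ⌋ then p ∷ [] else []) ++ r) ≡ (v ≐ x) * δ q p + countPol q r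
countPol-if q v x p r with v ≟ x
... | yes _ = cong (_+ countPol q r) (sym (*-identityˡ (δ q p)))
... | no _  = refl

countPol-premOcc : ∀ q x k i ps → countPol q (premOcc x k i ps) ≡ count q x (premSlots k i ps)
countPol-premOcc q x k i []       = refl
countPol-premOcc q x k i (p ∷ ps) =
  trans (countPol-if q p x (premPol k i) _)
        (cong ((p ≐ x) * δ q (premPol k i) +_) (countPol-premOcc q x k (suc i) ps))

countPol-occPols : ∀ q x ls → countPol q (occPols x ls) ≡ count q x (allSlots ls)
countPol-occPols q x []                   = refl
countPol-occPols q x (link ps k c ∷ ls) = begin
  countPol q (linkPols x (link ps k c) ++ occPols x ls)
    ≡⟨ countPol-++ q (linkPols x (link ps k c)) _ ⟩
  countPol q (linkPols x (link ps k c)) + countPol q (occPols x ls)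
    ≡⟨ cong₂ _+_ (trans (countPol-if q c x (conclPol k) _)
                        (cong ((c ≐ x) * δ q (conclPol k) +_) (countPol-premOcc q x k 0 ps)))
                 (countPol-occPols q x ls) ⟩
  count q x (slots (link ps k c)) + count q x (allSlots ls)
    ≡⟨ weigh-++ (_≐ x) q (slots (link ps k c)) _ ⟨
  count q x (allSlots (link ps k c ∷ ls)) ∎
  where open ≡-Reasoning

length-countPol : ∀ ps → length ps ≡ countPol pin ps + countPol pout ps
length-countPol []          = refl
length-countPol (pin ∷ ps)  = cong suc (length-countPol ps)
length-countPol (pout ∷ ps) = trans (cong suc (length-countPol ps)) (sym (+-suc (countPol pin ps) _))

ValidOcc⇒countPol≤1 : ∀ q ps → ValidOcc ps → countPol q ps ≤ 1
ValidOcc⇒countPol≤1 q (p ∷ [])      _    = subst (_≤ 1) (sym (+-identityʳ (δ q p))) (δ≤1 q p)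
ValidOcc⇒countPol≤1 q (p ∷ p′ ∷ []) p≢p′ rewrite ≢⇒dual p≢p′ =
  ≤-reflexive (trans (cong (δ q p +_) (+-identityʳ _)) (δ-dual q p))

-- Well-polarised slot lists

record WellPolarised (ty : ℕ → VTy) (ss : List Slot) : Set where
  field
    at-most-once : ∀ x q → count q x ss ≤ 1
    balanced     : ∀ x {A} → ty x ≡ bang A → count pout x ss ≤ count pin x ss
open WellPolarised

WellPolarised-↭ : ∀ {ty ss ss′} → ss ↭ ss′ → WellPolarised ty ss → WellPolarised ty ss′
WellPolarised-↭ {ss = ss} {ss′} ss↭ wp = record
  { at-most-once = λ x q → subst (_≤ 1) (count-↭ x q) (at-most-once wp x q)
  ; balanced     = λ x tx → subst₂ _≤_ (count-↭ x pout) (count-↭ x pin) (balanced wp x tx)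
  }
  where
  count-↭ : ∀ x q → count q x ss ≡ count q x ss′
  count-↭ x q = weigh-↭ (_≐ x) q ss↭

count-cut : ∀ q x w ss → count q x ((w , pout) ∷ (w , pin) ∷ ss) ≡ (w ≐ x) + count q x ss
count-cut q x w ss = begin
  d * δ q pout + (d * δ q pin + count q x ss)  ≡⟨ +-assoc (d * δ q pout) _ _ ⟨
  (d * δ q pout + d * δ q pin) + count q x ss  ≡⟨ cong (_+ count q x ss) (*-distribˡ-+ d (δ q pout) (δ q pin)) ⟨
  d * (δ q pout + δ q pin) + count q x ss      ≡⟨ cong (λ n → d * n + count q x ss) (δ-dual q pout) ⟩
  d * 1 + count q x ss                         ≡⟨ cong (_+ count q x ss) (*-identityʳ d) ⟩
  d + count q x ss                             ∎
  where
  open ≡-Reasoning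
  d = w ≐ x

WellPolarised-cut : ∀ {ty w ss} → WellPolarised ty ((w , pout) ∷ (w , pin) ∷ ss) → WellPolarised ty ss
WellPolarised-cut {w = w} {ss} wp = record
  { at-most-once = λ x q → ≤-trans (m≤n+m _ (w ≐ x)) (subst (_≤ 1) (count-cut q x w ss) (at-most-once wp x q))
  ; balanced     = λ x tx → +-cancelˡ-≤ (w ≐ x) _ _
                              (subst₂ _≤_ (count-cut pout x w ss) (count-cut pin x w ss) (balanced wp x tx))
  }

-- Merging two vertices

ren-cases : ∀ a b v → (v ≡ b × ren a b v ≡ a) ⊎ (v ≢ b × ren a b v ≡ v)
ren-cases a b v with v ≟ b
... | yes v≡b = inj₁ (v≡b , refl)
... | no v≢b  = inj₂ (v≢b , refl)

ren-self : ∀ a v → ren a a v ≡ v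
ren-self a v with ren-cases a a v
... | inj₁ (v≡a , e) = trans e (sym v≡a)
... | inj₂ (_ , e)   = e

ren-≐-target : ∀ {a b} → a ≢ b → ∀ v → ren a b v ≐ a ≡ (v ≐ a) + (v ≐ b)
ren-≐-target {a} {b} a≢b v with ren-cases a b v
... | inj₁ (refl , e) rewrite e = trans (≐-refl a) (sym (cong₂ _+_ (≐-≢ (a≢b ∘ sym)) (≐-refl v)))
... | inj₂ (v≢b , e) rewrite e = sym (trans (cong ((v ≐ a) +_) (≐-≢ v≢b)) (+-identityʳ _))

ren-≐-source : ∀ {a b} → a ≢ b → ∀ v → ren a b v ≐ b ≡ 0
ren-≐-source {a} {b} a≢b v with ren-cases a b v
... | inj₁ (_ , e)   rewrite e = ≐-≢ a≢b
... | inj₂ (v≢b , e) rewrite e = ≐-≢ v≢b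

ren-≐-other : ∀ {a b x} → x ≢ a → x ≢ b → ∀ v → ren a b v ≐ x ≡ v ≐ x
ren-≐-other {a} {b} {x} x≢a x≢b v with ren-cases a b v
... | inj₁ (refl , e) rewrite e = trans (≐-≢ (x≢a ∘ sym)) (sym (≐-≢ (x≢b ∘ sym)))
... | inj₂ (_ , e)    rewrite e = refl

module _ {a b : ℕ} (a≢b : a ≢ b) (p : Pol) (ss : List Slot) where

  count-merge-target : ∀ q → suc (count q a (renameSlots (ren a b) ss))
    ≡ count q a ((a , p) ∷ (b , dual p) ∷ ss) + count q b ((a , p) ∷ (b , dual p) ∷ ss)
  count-merge-target q = begin
    suc (count q a (renameSlots (ren a b) ss))
      ≡⟨ cong suc (trans (count-rename (ren a b) q a ss)
                         (weigh-+ {λ v → ren a b v ≐ a} {_≐ a} {_≐ b} (ren-≐-target a≢b) q ss)) ⟩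
    suc (count q a ss + count q b ss)
      ≡⟨ cong (_+ (count q a ss + count q b ss)) (δ-dual q p) ⟨
    (δ q p + δ q (dual p)) + (count q a ss + count q b ss)
      ≡⟨ interchange (δ q p) (δ q (dual p)) (count q a ss) (count q b ss) ⟩
    (δ q p + count q a ss) + (δ q (dual p) + count q b ss)
      ≡⟨ cong₂ _+_ (trans (count-∷-≡ q a p ((b , dual p) ∷ ss))
                          (cong (δ q p +_) (count-∷-≢ q a (dual p) ss (a≢b ∘ sym))))
                   (trans (count-∷-≢ q b p ((b , dual p) ∷ ss) a≢b) (count-∷-≡ q b (dual p) ss)) ⟨
    count q a ((a , p) ∷ (b , dual p) ∷ ss) + count q b ((a , p) ∷ (b , dual p) ∷ ss) ∎
    where open ≡-Reasoning

  count-merge-source : ∀ q → count q b (renameSlots (ren a b) ss) ≡ 0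
  count-merge-source q = trans (count-rename (ren a b) q b ss)
    (trans (weigh-cong {λ v → ren a b v ≐ b} {λ _ → 0} (ren-≐-source a≢b) q ss) (weigh-zero q ss))

  count-merge-other : ∀ {x} q → x ≢ a → x ≢ b →
    count q x (renameSlots (ren a b) ss) ≡ count q x ((a , p) ∷ (b , dual p) ∷ ss)
  count-merge-other {x} q x≢a x≢b = begin
    count q x (renameSlots (ren a b) ss)
      ≡⟨ count-rename (ren a b) q x ss ⟩
    weigh (λ v → ren a b v ≐ x) q ss
      ≡⟨ weigh-cong {λ v → ren a b v ≐ x} {_≐ x} (ren-≐-other x≢a x≢b) q ss ⟩
    count q x ss
      ≡⟨ count-∷-≢ q x (dual p) ss (x≢b ∘ sym) ⟨
    count q x ((b , dual p) ∷ ss)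
      ≡⟨ count-∷-≢ q x p ((b , dual p) ∷ ss) (x≢a ∘ sym) ⟨
    count q x ((a , p) ∷ (b , dual p) ∷ ss) ∎
    where open ≡-Reasoning

≤-of-suc-sums : ∀ {m n a₁ b₁ a₂ b₂} → suc m ≡ a₁ + b₁ → suc n ≡ a₂ + b₂ → a₁ ≤ a₂ → b₁ ≤ b₂ → m ≤ n
≤-of-suc-sums e₁ e₂ a₁≤a₂ b₁≤b₂ = s≤s⁻¹ (subst₂ _≤_ (sym e₁) (sym e₂) (+-mono-≤ a₁≤a₂ b₁≤b₂))

renameSlots-ren-self : ∀ a ss → renameSlots (ren a a) ss ≡ ss
renameSlots-ren-self a ss = trans (map-cong (λ s → cong (_, proj₂ s) (ren-self a (proj₁ s))) ss) (map-id ss)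

loop↭cut : ∀ a p (ss : List Slot) → (a , p) ∷ (a , dual p) ∷ ss ↭ (a , pout) ∷ (a , pin) ∷ ss
loop↭cut a pin  ss = swap (a , pin) (a , pout) ↭.refl
loop↭cut a pout ss = ↭.refl

WellPolarised-merge : ∀ {ty a b p ss} → ty a ≡ ty b →
  WellPolarised ty ((a , p) ∷ (b , dual p) ∷ ss) → WellPolarised ty (renameSlots (ren a b) ss)
WellPolarised-merge {ty} {a} {b} {p} {ss} ab wp with a ≟ b
... | yes refl = subst (WellPolarised ty) (sym (renameSlots-ren-self a ss))
                   (WellPolarised-cut {ty} {a} {ss} (WellPolarised-↭ (loop↭cut a p ss) wp))
... | no a≢b   = record { at-most-once = once ; balanced = bal }
  where
  once : ∀ x q → count q x (renameSlots (ren a b) ss) ≤ 1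
  once x q with x ≟ a | x ≟ b
  ... | yes refl | _        = ≤-of-suc-sums (count-merge-target a≢b p ss q) refl
                                (at-most-once wp a q) (at-most-once wp b q)
  ... | no _     | yes refl = subst (_≤ 1) (sym (count-merge-source a≢b p ss q)) z≤n
  ... | no x≢a   | no x≢b   = subst (_≤ 1) (sym (count-merge-other a≢b p ss q x≢a x≢b)) (at-most-once wp x q)
  bal : ∀ x {A} → ty x ≡ bang A →
    count pout x (renameSlots (ren a b) ss) ≤ count pin x (renameSlots (ren a b) ss)
  bal x {A} tx with x ≟ a | x ≟ b
  ... | yes refl | _        = ≤-of-suc-sums (count-merge-target a≢b p ss pout) (count-merge-target a≢b p ss pin)
                                (balanced wp a tx) (balanced wp b {A} (trans (sym ab) tx))
  ... | no _     | yes refl = subst (_≤ count pin b (renameSlots (ren a b) ss))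
                                (sym (count-merge-source a≢b p ss pout)) z≤n
  ... | no x≢a   | no x≢b   = subst₂ _≤_ (sym (count-merge-other a≢b p ss pout x≢a x≢b))
                                         (sym (count-merge-other a≢b p ss pin x≢a x≢b))
                                (balanced wp x tx)

SameType : (ℕ → VTy) → ℕ × ℕ → Set
SameType ty (a , b) = ty a ≡ ty b

TypePreserving : (ℕ → VTy) → (ℕ → ℕ) → Set
TypePreserving ty ρ = ∀ v → ty (ρ v) ≡ ty v

ren-type-preserving : ∀ ty {a b} → ty a ≡ ty b → TypePreserving ty (ren a b)
ren-type-preserving ty {a} {b} ab v with ren-cases a b v
... | inj₁ (refl , e) = trans (cong ty e) ab
... | inj₂ (_ , e)    = cong ty e

merge-type-preserving : ∀ {ty σ a b} → TypePreserving ty σ → ty a ≡ ty b →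
  TypePreserving ty (λ v → ren (σ a) (σ b) (σ v))
merge-type-preserving {ty} {σ} {a} {b} σ-pres ab v =
  trans (ren-type-preserving ty (trans (σ-pres a) (trans ab (sym (σ-pres b)))) (σ v)) (σ-pres v)

quot-type-preserving : ∀ {ty σ} ps → All (SameType ty) ps → TypePreserving ty σ →
  TypePreserving ty (quot ps σ)
quot-type-preserving []       []          σ-pres = σ-pres
quot-type-preserving (_ ∷ ps) (ab ∷ same) σ-pres = quot-type-preserving ps same (merge-type-preserving σ-pres ab)

-- In a cut-elimination step, P is the list of slots left behind by the premises of the two
-- cut links.
data Pairing : List (ℕ × ℕ) → List Slot → Set where
  []  : Pairing [] []
  _∷_ : ∀ {a b ps ss} p → Pairing ps ss → Pairing ((a , b) ∷ ps) ((a , p) ∷ (b , dual p) ∷ ss)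

WellPolarised-identify : ∀ {ty ps P σ} ss → Pairing ps P → All (SameType ty) ps → TypePreserving ty σ →
  WellPolarised ty (renameSlots σ (P ++ ss)) → WellPolarised ty (renameSlots (quot ps σ) ss)
WellPolarised-identify ss [] [] σ-pres wp = wp
WellPolarised-identify {ty} {σ = σ} ss (_∷_ {a} {b} {ss = P} p π) (ab ∷ same) σ-pres wp =
  WellPolarised-identify ss π same (merge-type-preserving σ-pres ab)
    (subst (WellPolarised ty) (sym (map-∘ (P ++ ss)))
      (WellPolarised-merge (trans (σ-pres a) (trans ab (sym (σ-pres b)))) wp))

LinkTyped-rename : ∀ {ty ρ} → TypePreserving ty ρ → ∀ l → LinkTyped ty l → LinkTyped ty (renameLink ρ l)
LinkTyped-rename ρ-pres (link ps kStar c) tc = trans (ρ-pres c) tc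
LinkTyped-rename ρ-pres (link (u ∷ v ∷ []) kLolli c) (A , B , tu , tv , tc) =
  A , B , trans (ρ-pres u) tu , trans (ρ-pres v) tv , trans (ρ-pres c) tc
LinkTyped-rename ρ-pres (link (u ∷ v ∷ []) kLolliBar c) (A , B , tu , tv , tc) =
  A , B , trans (ρ-pres u) tu , trans (ρ-pres v) tv , trans (ρ-pres c) tc
LinkTyped-rename ρ-pres (link ps kBang c) (A , tps , tc) =
  A , AllP.map⁺ (All.map (λ {p} tp → trans (ρ-pres p) tp) tps) , trans (ρ-pres c) tc
LinkTyped-rename ρ-pres (link ps kWhy c) (A , tps , tc) =
  A , AllP.map⁺ (All.map (λ {p} tp → trans (ρ-pres p) tp) tps) , trans (ρ-pres c) tc

ArityOK-rename : ∀ ρ l → ArityOK l → ArityOK (renameLink ρ l)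
ArityOK-rename ρ (link .[] kStar c) refl = refl
ArityOK-rename ρ (link ps kLolli c)    ar = trans (length-map ρ ps) ar
ArityOK-rename ρ (link ps kLolliBar c) ar = trans (length-map ρ ps) ar
ArityOK-rename ρ (link ps kBang c)     ar = ar
ArityOK-rename ρ (link ps kWhy c)      ar = ar

bang≢base : ∀ {T A B} → T ≡ bang A → T ≡ base B → ⊥
bang≢base refl ()

data ExpSlot (x : ℕ) : Pol → Link → Set where
  bang-concl   : ∀ {ps}  → ExpSlot x pout (link ps kBang x)
  why-concl    : ∀ {ps}  → ExpSlot x pin  (link ps kWhy x)
  lolli-arg    : ∀ {v c} → ExpSlot x pout (link (x ∷ v ∷ []) kLolli c)
  lolliBar-arg : ∀ {v c} → ExpSlot x pin  (link (x ∷ v ∷ []) kLolliBar c)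

expSlot : ∀ {ty x A q} l → ty x ≡ bang A → LinkTyped ty l → ArityOK l → (x , q) ∈ slots l →
  ExpSlot x q l
expSlot (link _ kStar _) tx tc refl (here refl) = ⊥-elim (bang≢base tx tc)
expSlot (link (_ ∷ _ ∷ []) kLolli _) tx (_ , _ , _ , _ , tc) _ (here refl)                 = ⊥-elim (bang≢base tx tc)
expSlot (link (_ ∷ _ ∷ []) kLolli _) _  _                    _ (there (here refl))         = lolli-arg
expSlot (link (_ ∷ _ ∷ []) kLolli _) tx (_ , _ , _ , tv , _) _ (there (there (here refl))) = ⊥-elim (bang≢base tx tv)
expSlot (link (_ ∷ _ ∷ []) kLolliBar _) tx (_ , _ , _ , _ , tc) _ (here refl)                 = ⊥-elim (bang≢base tx tc)
expSlot (link (_ ∷ _ ∷ []) kLolliBar _) _  _                    _ (there (here refl))         = lolliBar-arg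
expSlot (link (_ ∷ _ ∷ []) kLolliBar _) tx (_ , _ , _ , tv , _) _ (there (there (here refl))) = ⊥-elim (bang≢base tx tv)
expSlot (link _ kBang _) _  _             _ (here refl) = bang-concl
expSlot (link _ kBang _) tx (_ , tps , _) _ (there s)   =
  ⊥-elim (bang≢base tx (All.lookup tps (∈-premSlots⇒∈ s)))
expSlot (link _ kWhy _)  _  _             _ (here refl) = why-concl
expSlot (link _ kWhy _)  tx (_ , tps , _) _ (there s)   =
  ⊥-elim (bang≢base tx (All.lookup tps (∈-premSlots⇒∈ s)))

-- The invariant along reduction

record Invariant (N : PreNet) : Set where
  field
    polarised : WellPolarised (ty N) (allSlots (links N))
    typed     : WellTyped N
    arities   : All ArityOK (links N)
open Invariant

cut-preserves : ∀ {ls ty l₁ l₂ rest w P ps} → Invariant (mkNet ls ty) → ls ↭ l₁ ∷ l₂ ∷ rest →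
  allSlots (l₁ ∷ l₂ ∷ rest) ↭ (w , pout) ∷ (w , pin) ∷ P ++ allSlots rest →
  Pairing ps P → All (SameType ty) ps → Invariant (mkNet (identify ps rest) ty)
cut-preserves {ls} {ty} {rest = rest} {P = P} {ps} inv ls↭ slots↭ π same = record
  { polarised = subst (WellPolarised ty) (sym (allSlots-rename (quot ps id) rest)) identified
  ; typed     = AllP.map⁺ (All.map (λ {l} → LinkTyped-rename quot-preserving l) (drop-cut (typed inv)))
  ; arities   = AllP.map⁺ (All.map (λ {l} → ArityOK-rename (quot ps id) l) (drop-cut (arities inv)))
  }
  where
  drop-cut : ∀ {Q : Link → Set} → All Q ls → All Q rest
  drop-cut = All.tail ∘ All.tail ∘ All-resp-↭ ls↭
  cut-removed : WellPolarised ty (P ++ allSlots rest)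
  cut-removed = WellPolarised-cut (WellPolarised-↭ (↭-trans (allSlots-↭ ls↭) slots↭) (polarised inv))
  identified : WellPolarised ty (renameSlots (quot ps id) (allSlots rest))
  identified = WellPolarised-identify (allSlots rest) π same (λ _ → refl)
                 (subst (WellPolarised ty) (sym (map-id (P ++ allSlots rest))) cut-removed)
  quot-preserving : TypePreserving ty (quot ps id)
  quot-preserving = quot-type-preserving ps same (λ _ → refl)

lin-cut-types : ∀ {ty u v u′ v′ w} → LinTyped ty (u ∷ v ∷ []) w → LinTyped ty (u′ ∷ v′ ∷ []) w →
  All (SameType ty) ((u , u′) ∷ (v , v′) ∷ [])
lin-cut-types (_ , _ , tu , tv , tw) (_ , _ , tu′ , tv′ , tw′) with trans (sym tw) tw′
... | refl = trans tu (sym tu′) ∷ trans tv (sym tv′) ∷ []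

lin-cut-preserves : ∀ {ls ty u v u′ v′ w rest} → Invariant (mkNet ls ty) →
  ls ↭ link (u ∷ v ∷ []) kLolli w ∷ link (u′ ∷ v′ ∷ []) kLolliBar w ∷ rest →
  Invariant (mkNet (identify ((u , u′) ∷ (v , v′) ∷ []) rest) ty)
lin-cut-preserves inv ls↭ with All-resp-↭ ls↭ (typed inv)
... | t₁ ∷ t₂ ∷ _ =
  cut-preserves inv ls↭ (prep _ (↭-trans (shift _ (_ ∷ _ ∷ []) _) (prep _ (prep _ (swap _ _ ↭.refl)))))
    (pout ∷ pin ∷ []) (lin-cut-types t₁ t₂)

∈-insertions⇒↭ : ∀ {A : Set} (x : A) xs {ys} → ys ∈ insertions x xs → ys ↭ x ∷ xs
∈-insertions⇒↭ x []       (here refl) = ↭.refl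
∈-insertions⇒↭ x (y ∷ xs) (here refl) = ↭.refl
∈-insertions⇒↭ x (y ∷ xs) (there m) with ∈-map⁻ (y ∷_) m
... | zs , zs∈ , refl = ↭-trans (prep y (∈-insertions⇒↭ x xs zs∈)) (swap y x ↭.refl)

∈-perms⇒↭ : ∀ {A : Set} (xs : List A) {ys} → ys ∈ perms xs → ys ↭ xs
∈-perms⇒↭ []       (here refl) = ↭.refl
∈-perms⇒↭ (x ∷ xs) m with ∈-concat⁻′ (map (insertions x) (perms xs)) m
... | zs , ys∈zs , zs∈ with ∈-map⁻ (insertions x) zs∈
...   | ws , ws∈ , refl = ↭-trans (∈-insertions⇒↭ x ws ys∈zs) (prep x (∈-perms⇒↭ xs ws∈))

premSlots-bang : ∀ i vs → premSlots kBang i vs ≡ map (_, pin) vs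
premSlots-bang i []       = refl
premSlots-bang i (v ∷ vs) = cong (_ ∷_) (premSlots-bang (suc i) vs)

premSlots-why : ∀ i us → premSlots kWhy i us ≡ map (_, pout) us
premSlots-why i []       = refl
premSlots-why i (u ∷ us) = cong (_ ∷_) (premSlots-why (suc i) us)

zip-Pairing : ∀ vs us → length vs ≡ length us →
  ∃ λ P → Pairing (zip vs us) P × map (_, pin) vs ++ map (_, pout) us ↭ P
zip-Pairing []       []       _  = [] , [] , ↭.refl
zip-Pairing (v ∷ vs) (u ∷ us) eq with zip-Pairing vs us (suc-injective eq)
... | P , π , ↭P = _ , pin ∷ π , prep _ (↭-trans (shift _ (map _ vs) _) (prep _ ↭P))

zip-SameType : ∀ {ty T vs us} → All (λ v → ty v ≡ T) vs → All (λ u → ty u ≡ T) us →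
  All (SameType ty) (zip vs us)
zip-SameType []         _          = []
zip-SameType (_ ∷ _)    []         = []
zip-SameType (tv ∷ tvs) (tu ∷ tus) = trans tv (sym tu) ∷ zip-SameType tvs tus

exp-cut-types : ∀ {ty vs us us′ w} → ExpTyped ty vs w → ExpTyped ty us w → us′ ↭ us →
  All (SameType ty) (zip vs us′)
exp-cut-types (_ , tvs , tw) (_ , tus , tw′) us′↭us with trans (sym tw) tw′
... | refl = zip-SameType tvs (All-resp-↭ (↭-sym us′↭us) tus)

exp-cut-slots : ∀ {vs us us′ w rest P} → us′ ↭ us → map (_, pin) vs ++ map (_, pout) us′ ↭ P →
  allSlots (link vs kBang w ∷ link us kWhy w ∷ rest) ↭ (w , pout) ∷ (w , pin) ∷ P ++ allSlots rest
exp-cut-slots {vs} {us} {rest = rest} us′↭us ↭P =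
  prep _ (↭-trans (shift _ (premSlots kBang 0 vs) _) (prep _ (↭-trans
    (↭-reflexive (sym (++-assoc (premSlots kBang 0 vs) _ _)))
    (++⁺ʳ (allSlots rest)
      (↭-trans (↭-reflexive (cong₂ _++_ (premSlots-bang 0 vs) (premSlots-why 0 us)))
        (↭-trans (++⁺ˡ (map (_, pin) vs) (map⁺ _ (↭-sym us′↭us))) ↭P))))))

exp-cut-preserves : ∀ {ls ty vs us w rest us′} → Invariant (mkNet ls ty) →
  ls ↭ link vs kBang w ∷ link us kWhy w ∷ rest → length vs ≡ length us → us′ ∈ perms us →
  Invariant (mkNet (identify (zip vs us′) rest) ty)
exp-cut-preserves {vs = vs} {us} {rest = rest} {us′} inv ls↭ len us′∈
  with All-resp-↭ ls↭ (typed inv)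
... | t₁ ∷ t₂ ∷ _ =
  let P , π , ↭P = zip-Pairing vs us′ (trans len (sym (↭-length us′↭us))) in
  cut-preserves inv ls↭ (exp-cut-slots {rest = rest} us′↭us ↭P) π (exp-cut-types t₁ t₂ us′↭us)
  where us′↭us = ∈-perms⇒↭ us us′∈

⇒-preserves : ∀ {N R} → N ⇒ R → Invariant N → All Invariant R
⇒-preserves (⇒lin ls↭)     inv = lin-cut-preserves inv ls↭ ∷ []
⇒-preserves (⇒exp ls↭ len) inv = AllP.map⁺ (All.tabulate (exp-cut-preserves inv ls↭ len))
⇒-preserves (⇒exp0 _ _)    _   = []

↝-preserves : ∀ {S S′} → S ↝ S′ → All Invariant S → All Invariant S′
↝-preserves (step {A} N⇒R) invs =
  AllP.++⁺ (AllP.++⁻ˡ A invs)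
           (AllP.++⁺ (⇒-preserves N⇒R (All.head (AllP.++⁻ʳ A invs))) (All.tail (AllP.++⁻ʳ A invs)))

↝*-preserves : ∀ {S S′} → S ↝* S′ → All Invariant S → All Invariant S′
↝*-preserves ε        invs = invs
↝*-preserves (r ◅ rs) invs = ↝*-preserves rs (↝-preserves r invs)

-- The translation

Partnered : List Link → Link → Set
Partnered L (link _ kBang c)        = (c , pin) ∈ allSlots L
Partnered L (link (u ∷ _) kLolli _) = (u , pin) ∈ allSlots L
Partnered L _                       = ⊤

Partnered-mono : ∀ {L L′} → L ⊆ L′ → ∀ {l} → Partnered L l → Partnered L′ l
Partnered-mono L⊆ {link _ kBang _}        p = allSlots-⊆ L⊆ p
Partnered-mono L⊆ {link (_ ∷ _) kLolli _} p = allSlots-⊆ L⊆ p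
Partnered-mono L⊆ {link [] kLolli _}      p = tt
Partnered-mono L⊆ {link _ kStar _}        p = tt
Partnered-mono L⊆ {link _ kLolliBar _}    p = tt
Partnered-mono L⊆ {link _ kWhy _}         p = tt

mutual
  tr-partnered : ∀ t n → All (Partnered (TrOut.tlinks (tr t n))) (TrOut.tlinks (tr t n))
  tr-partnered star    n = tt ∷ []
  tr-partnered (var x) n = []
  tr-partnered (lam x t) n with tr t n | tr-partnered t n
  ... | trOut o ls oc a | ih = tt ∷ here refl ∷ All.map (Partnered-mono (there ∘ there)) ih
  tr-partnered (app t B) n with tr t n | tr-partnered t n
  ... | trOut o ls oc m | ih with trBag B m | trBag-partnered B m
  ... | bagOut os bls boc b | ihB =
    tt ∷ there (here refl) ∷ AllP.++⁺ (All.map (Partnered-mono (there ∘ there ∘ ∈-++⁺ˡ)) ih)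
                                      (All.map (Partnered-mono (there ∘ there ∘ ∈-++⁺ʳ ls)) ihB)

  trBag-partnered : ∀ B n → All (Partnered (BagOut.blinks (trBag B n))) (BagOut.blinks (trBag B n))
  trBag-partnered []       n = []
  trBag-partnered (s ∷ ss) n with tr s n | tr-partnered s n
  ... | trOut o ls oc m | ih with trBag ss m | trBag-partnered ss m
  ... | bagOut os bls boc k | ihB =
    AllP.++⁺ (All.map (Partnered-mono ∈-++⁺ˡ) ih) (All.map (Partnered-mono (∈-++⁺ʳ ls)) ihB)

closeFV-partnered : ∀ L xs occ n → All (Partnered L) (closeFV xs occ n)
closeFV-partnered L []       occ n = []
closeFV-partnered L (x ∷ xs) occ n = tt ∷ closeFV-partnered L xs occ (suc n)

⟦⟧-partnered : ∀ t → All (Partnered ⟦ t ⟧) ⟦ t ⟧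
⟦⟧-partnered t with tr t 0 | tr-partnered t 0
... | trOut o ls oc m | ih = AllP.++⁺ (All.map (Partnered-mono ∈-++⁺ˡ) ih) (closeFV-partnered _ _ oc m)

partner-in : ∀ {L l x} → Partnered L l → ExpSlot x pout l → (x , pin) ∈ allSlots L
partner-in p bang-concl = p
partner-in p lolli-arg  = p

preNet-at-most-once : ∀ {ls} → IsPreNet ls → ∀ x q → count q x (allSlots ls) ≤ 1
preNet-at-most-once {ls} (_ , valid) x q with 1 ≤? count q x (allSlots ls)
... | no ¬pos = <⇒≤ (≰⇒> ¬pos)
... | yes pos = subst (_≤ 1) (countPol-occPols q x ls)
                  (ValidOcc⇒countPol≤1 q _ (valid x (∈-allSlots⇒∈-vertices ls (count-pos⇒∈ q x _ pos))))

≤-via-1 : ∀ {m n} → m ≤ 1 → (1 ≤ m → 1 ≤ n) → m ≤ n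
≤-via-1 {zero}  _         _   = z≤n
≤-via-1 {suc _} (s≤s z≤n) pos = pos (s≤s z≤n)

⟦⟧-invariant : ∀ t ty → IsPreNet ⟦ t ⟧ → WellTyped (mkNet ⟦ t ⟧ ty) → Invariant (mkNet ⟦ t ⟧ ty)
⟦⟧-invariant t ty pre wt = record
  { polarised = record { at-most-once = preNet-at-most-once pre ; balanced = balanced′ }
  ; typed     = wt
  ; arities   = proj₁ pre
  }
  where
  balanced′ : ∀ x {A} → ty x ≡ bang A →
    count pout x (allSlots ⟦ t ⟧) ≤ count pin x (allSlots ⟦ t ⟧)
  balanced′ x tx = ≤-via-1 (preNet-at-most-once pre x pout) λ out-pos →
    let l , l∈ , s = ∈-allSlots⁻ ⟦ t ⟧ (count-pos⇒∈ pout x _ out-pos) in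
    ∈⇒count-pos (partner-in (All.lookup (⟦⟧-partnered t) l∈)
                            (expSlot l tx (All.lookup wt l∈) (All.lookup (proj₁ pre) l∈) s))

simpleNet-invariant : ∀ {N} → SimpleNet N → Invariant N
simpleNet-invariant (t , ty , _ , pre , wt , ⟦t⟧↝*S , N∈S) =
  All.lookup (↝*-preserves ⟦t⟧↝*S (⟦⟧-invariant t ty pre wt ∷ [])) N∈S

-- Closed nets

closed-in⇒out : ∀ {N x} → Closed N → Invariant N →
  1 ≤ count pin x (allSlots (links N)) → 1 ≤ count pout x (allSlots (links N))
closed-in⇒out {N} {x} (v , v-out , unique) inv in-pos with 1 ≤? count pout x (allSlots (links N))
... | yes out-pos = out-pos
... | no ¬out-pos = ⊥-elim (1+n≢0 (begin
    1                                ≡⟨ in≡1 ⟨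
    count pin x (allSlots ls)        ≡⟨ countPol-occPols pin x ls ⟨
    countPol pin (occPols x ls)      ≡⟨ cong (λ y → countPol pin (occPols y ls)) x≡v ⟩
    countPol pin (occPols v ls)      ≡⟨ cong (countPol pin) v-out ⟩
    0                                ∎))
  where
  open ≡-Reasoning
  ls = links N
  in≡1 : count pin x (allSlots ls) ≡ 1
  in≡1 = ≤-antisym (at-most-once (polarised inv) x pin) in-pos
  length≡1 : length (occPols x ls) ≡ 1
  length≡1 = trans (length-countPol (occPols x ls))
                   (cong₂ _+_ (trans (countPol-occPols pin x ls) in≡1)
                              (trans (countPol-occPols pout x ls) (n<1⇒n≡0 (≰⇒> ¬out-pos))))
  x≡v : x ≡ v
  x≡v = unique x (∈-allSlots⇒∈-vertices ls (count-pos⇒∈ pin x _ in-pos)) length≡1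

exp-conclusion-type : ∀ {ty} l → IsExp (kind l) → LinkTyped ty l → ∃ λ A → ty (concl l) ≡ bang A
exp-conclusion-type (link _ kBang _) expBang (A , _ , tc) = A , tc
exp-conclusion-type (link _ kWhy _)  expWhy  (A , _ , tc) = A , tc

Invariant-expSlot : ∀ {N x A q l} → Invariant N → ty N x ≡ bang A → l ∈ links N → (x , q) ∈ slots l →
  ExpSlot x q l
Invariant-expSlot {l = l} inv tx l∈ = expSlot l tx (All.lookup (typed inv) l∈) (All.lookup (arities inv) l∈)

exp-conclusion-reoccurs : ∀ {N} → Closed N → Invariant N → ∀ {l} → l ∈ links N → IsExp (kind l) →
  (concl l , dual (conclPol (kind l))) ∈ allSlots (links N)
exp-conclusion-reoccurs closed inv {l@(link ps kBang c)} l∈ expBang =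
  count-pos⇒∈ pin c _ (≤-trans (∈⇒count-pos (∈-allSlots⁺ l∈ (here refl))) (balanced (polarised inv) c tc))
  where tc = proj₂ (exp-conclusion-type l expBang (All.lookup (typed inv) l∈))
exp-conclusion-reoccurs closed inv {link ps kWhy c} l∈ expWhy =
  count-pos⇒∈ pout c _ (closed-in⇒out closed inv (∈⇒count-pos (∈-allSlots⁺ l∈ (here refl))))

exp-conclusion-not-dual : ∀ {ty} l → IsExp (kind l) → LinkTyped ty l →
  (concl l , dual (conclPol (kind l))) ∉ slots l
exp-conclusion-not-dual l@(link _ kBang _) expBang t@(_ , _ , tc) s with expSlot l tc t tt s
... | ()
exp-conclusion-not-dual l@(link _ kWhy _)  expWhy  t@(_ , _ , tc) s with expSlot l tc t tt s
... | ()

exp-conclusion-reoccurs-in-rest : ∀ {N l rest} → Closed N → Invariant N → links N ↭ l ∷ rest →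
  IsExp (kind l) → (concl l , dual (conclPol (kind l))) ∈ allSlots rest
exp-conclusion-reoccurs-in-rest {l = l} closed inv ls↭ l-exp =
  [ (λ in-l → ⊥-elim (exp-conclusion-not-dual l l-exp (All.lookup (typed inv) l∈) in-l)) , id ]′
    (∈-++⁻ (slots l) (∈-resp-↭ (allSlots-↭ ls↭) (exp-conclusion-reoccurs closed inv l∈ l-exp)))
  where l∈ = ∈-resp-↭ (↭-sym ls↭) (here refl)

cut-or-first-premise : ∀ {c q l′ ls rest} → rest ⊆ ls → l′ ∈ rest → ExpSlot c q l′ →
  FirstPremiseOfLin c ls ⊎ CutWithExp c rest
cut-or-first-premise _     l′∈ bang-concl   = inj₂ (_ , l′∈ , expBang , refl)
cut-or-first-premise _     l′∈ why-concl    = inj₂ (_ , l′∈ , expWhy , refl)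
cut-or-first-premise rest⊆ l′∈ lolli-arg    = inj₁ (_ , rest⊆ l′∈ , linLolli , _ , refl)
cut-or-first-premise rest⊆ l′∈ lolliBar-arg = inj₁ (_ , rest⊆ l′∈ , linLolliBar , _ , refl)

mainTheorem1 : (N : PreNet) → SimpleNet N → Closed N →
    (l : Link) (rest : List Link) → links N ↭ (l ∷ rest) → IsExp (kind l) →
    FirstPremiseOfLin (concl l) (links N) ⊎ CutWithExp (concl l) rest
mainTheorem1 N simple closed l rest ls↭ l-exp =
  let l′ , l′∈ , s = ∈-allSlots⁻ rest (exp-conclusion-reoccurs-in-rest closed inv ls↭ l-exp)
      _ , tc = exp-conclusion-type l l-exp (All.lookup (typed inv) (∈-resp-↭ (↭-sym ls↭) (here refl)))
  in cut-or-first-premise rest⊆ l′∈ (Invariant-expSlot inv tc (rest⊆ l′∈) s)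
  where
  inv = simpleNet-invariant simple
  rest⊆ : rest ⊆ links N
  rest⊆ = ∈-resp-↭ (↭-sym ls↭) ∘ there
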